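{- Let $\mathrm{sort}$ be a sort function satisfying the characteristic property. Let $T, T'$ be types, $\leq_T$ a relation on $T$, $f : T' \to T$, and $xs : \mathrm{list}\,T'$. Define the relation $\leq_{T'}$ on $T'$ by $x \leq_{T'} y := f\,x \leq_T f\,y$. Then $\mathrm{sort}_{\leq_T}\,(\mathrm{map}\,f\,xs) = \mathrm{map}\,f\,(\mathrm{sort}_{\leq_{T'}}\,xs)$.
   Context: $\mathrm{map}\,f\,[a_1,\dots,a_n] = [f\,a_1,\dots,f\,a_n]$. Lists: $[]$ is the empty list, $x :: s$ is cons, $[x]$ is the singleton list, $\mathbin{+\!\!+}$ is concatenation. A "relation" $\leq$ on a type $T$ is a function $T \to T \to \mathrm{bool}$. The merge of two lists w.r.t. $\leq$ is defined by $[] \mathbin{\land\hspace{ -.45em}\land}_\leq ys = ys$, $xs \mathbin{\land\hspace{ -.45em}\land}_\leq [] = xs$, and $(x :: xs) \mathbin{\land\hspace{ -.45em}\land}_\leq (y :: ys) = x :: (xs \mathbin{\land\hspace{ -.45em}\land}_\leq (y :: ys))$ if $x \leq y$, and $= y :: ((x :: xs) \mathbin{\land\hspace{ -.45em}\land}_\leq ys)$ otherwise. A sort function $\mathrm{sort}$ assigns to every type $T$ and relation $\leq$ on $T$ a function $\mathrm{sort}_\leq : \mathrm{list}\,T \to \mathrm{list}\,T$. It satisfies the characteristic property if there is a polymorphic function $\mathrm{asort}$ of type $\forall (T\,R : \mathcal{U}), (R \to R \to R) \to (T \to R) \to R \to \mathrm{list}\,T \to R$ such that: (1) for all $T$, $\leq$,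 $xs$: $\mathrm{asort}\,(\mathbin{\land\hspace{ -.45em}\land}_\leq)\,(\lambda x.[x])\,[]\,xs = \mathrm{sort}_\leq\,xs$; (2) for all $T$, $xs$: $\mathrm{asort}\,(\mathbin{+\!\!+})\,(\lambda x.[x])\,[]\,xs = xs$; (3) $\mathrm{asort}$ is relationally parametric: for all types $T_1,T_2$ and relation $\sim_T \subseteq T_1 \times T_2$, all types $R_1,R_2$ and relation $\sim_R \subseteq R_1\times R_2$, all $m_i : R_i \to R_i \to R_i$ with $a_1 \sim_R a_2 \wedge b_1 \sim_R b_2 \Rightarrow m_1\,a_1\,b_1 \sim_R m_2\,a_2\,b_2$, all $s_i : T_i \to R_i$ with $x_1 \sim_T x_2 \Rightarrow s_1\,x_1 \sim_R s_2\,x_2$, all $e_i : R_i$ with $e_1 \sim_R e_2$, and all lists $xs_1 : \mathrm{list}\,T_1$, $xs_2 : \mathrm{list}\,T_2$ of equal length that are pointwise $\sim_T$-related, we have $\mathrm{asort}\,m_1\,s_1\,e_1\,xs_1 \sim_R \mathrm{asort}\,m_2\,s_2\,e_2\,xs_2$. -}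

module Defs where

open import Data.Bool using (Bool; true; false; if_then_else_)
open import Data.List using (List; []; _∷_; _++_; [_]; map)
open import Data.List.Relation.Binary.Pointwise using (Pointwise)
open import Relation.Binary.PropositionalEquality using (_≡_)

Rel : Set → Set
Rel T = T → T → Bool

-- merge xs ys w.r.t. ≤ (the paper's ∧∧), written with an inner helper
-- so that termination is structural.
merge : {T : Set} → Rel T → List T → List T → List T
merge _≤_ [] ys = ys
merge {T} _≤_ (x ∷ xs) ys = go ys
  where
  go : List T → List T
  go [] = x ∷ xs
  go (y ∷ ys') = if x ≤ y then x ∷ merge _≤_ xs (y ∷ ys') else y ∷ go ys'

SortFun : Set₁
SortFun = {T : Set} → Rel T → List T → List T

ASortType : Set₁
ASortType = (T R : Set) → (R → R → R) → (T → R) → R → List T → R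

Parametric : ASortType → Set₁
Parametric asort =
  (T₁ T₂ : Set) (_∼T_ : T₁ → T₂ → Set)
  (R₁ R₂ : Set) (_∼R_ : R₁ → R₂ → Set)
  (m₁ : R₁ → R₁ → R₁) (m₂ : R₂ → R₂ → R₂) →
  (∀ {a₁ a₂ b₁ b₂} → a₁ ∼R a₂ → b₁ ∼R b₂ → m₁ a₁ b₁ ∼R m₂ a₂ b₂) →
  (s₁ : T₁ → R₁) (s₂ : T₂ → R₂) →
  (∀ {x₁ x₂} → x₁ ∼T x₂ → s₁ x₁ ∼R s₂ x₂) →
  (e₁ : R₁) (e₂ : R₂) → e₁ ∼R e₂ →
  (xs₁ : List T₁) (xs₂ : List T₂) → Pointwise _∼T_ xs₁ xs₂ →
  asort T₁ R₁ m₁ s₁ e₁ xs₁ ∼R asort T₂ R₂ m₂ s₂ e₂ xs₂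

record CharacteristicProperty (sort : SortFun) : Set₁ where
  field
    asort      : ASortType
    asort-sort : (T : Set) (_≤_ : Rel T) (xs : List T) →
                 asort T (List T) (merge _≤_) [_] [] xs ≡ sort _≤_ xs
    asort-cat  : (T : Set) (xs : List T) →
                 asort T (List T) _++_ [_] [] xs ≡ xs
    asort-param : Parametric asort

{-# OPTIONS --safe #-}
module Submission where

open import Defs
open import Data.Bool using (true; false)
open import Data.List using (List; []; _∷_; [_]; map)
open import Data.List.Relation.Binary.Pointwise using (Pointwise; []; _∷_)
open import Function.Base using (_on_)
open import Relation.Binary.PropositionalEquality
  using (_≡_; refl; cong; cong₂; trans; module ≡-Reasoning)

pointwise-graph-map : {A B : Set} (h : A → B) (xs : List A) →
                      Pointwise (λ x y → h x ≡ y) xs (map h xs)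
pointwise-graph-map h []       = []
pointwise-graph-map h (x ∷ xs) = refl ∷ pointwise-graph-map h xs

-- Parametricity instantiated at the graph relations of h and g.
module _ (asort : ASortType) (param : Parametric asort)
         {T₁ T₂ R₁ R₂ : Set} (h : T₁ → T₂) (g : R₁ → R₂)
         {m₁ : R₁ → R₁ → R₁} {m₂ : R₂ → R₂ → R₂}
         {s₁ : T₁ → R₁} {s₂ : T₂ → R₂} {e₁ : R₁} {e₂ : R₂} where

  asort-free-theorem : (∀ a b → g (m₁ a b) ≡ m₂ (g a) (g b)) →
                       (∀ x → g (s₁ x) ≡ s₂ (h x)) → g e₁ ≡ e₂ →
                       (xs : List T₁) →
                       g (asort T₁ R₁ m₁ s₁ e₁ xs) ≡ asort T₂ R₂ m₂ s₂ e₂ (map h xs)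
  asort-free-theorem g-m g-s g-e xs =
    param T₁ T₂ (λ x y → h x ≡ y) R₁ R₂ (λ a b → g a ≡ b) m₁ m₂
      (λ {a₁} {_} {b₁} ga≡ gb≡ → trans (g-m a₁ b₁) (cong₂ m₂ ga≡ gb≡))
      s₁ s₂ (λ { {x} refl → g-s x })
      e₁ e₂ g-e xs (map h xs) (pointwise-graph-map h xs)

map-merge-on : {T T′ : Set} (_≤_ : Rel T) (f : T′ → T) (xs ys : List T′) →
               map f (merge (_≤_ on f) xs ys) ≡ merge _≤_ (map f xs) (map f ys)
map-merge-on _≤_ f []       ys = refl
map-merge-on _≤_ f (x ∷ xs) ys = go ys
  where
  go : ∀ ys → map f (merge (_≤_ on f) (x ∷ xs) ys) ≡ merge _≤_ (map f (x ∷ xs)) (map f ys)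
  go []       = refl
  go (y ∷ ys) with f x ≤ f y
  ... | true  = cong (f x ∷_) (map-merge-on _≤_ f xs (y ∷ ys))
  ... | false = cong (f y ∷_) (go ys)

lemma3p14 : (sort : SortFun) → CharacteristicProperty sort →
            (T T′ : Set) (_≤T_ : Rel T) (f : T′ → T) (xs : List T′) →
            sort _≤T_ (map f xs) ≡ map f (sort (λ x y → f x ≤T f y) xs)
lemma3p14 sort cp T T′ _≤T_ f xs = begin
  sort _≤T_ (map f xs)
    ≡⟨ asort-sort T _≤T_ (map f xs) ⟨
  asort T (List T) (merge _≤T_) [_] [] (map f xs)
    ≡⟨ asort-free-theorem asort asort-param f (map f)
         (map-merge-on _≤T_ f) (λ _ → refl) refl xs ⟨
  map f (asort T′ (List T′) (merge (_≤T_ on f)) [_] [] xs)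
    ≡⟨ cong (map f) (asort-sort T′ (_≤T_ on f) xs) ⟩
  map f (sort (_≤T_ on f) xs) ∎
  where
  open CharacteristicProperty cp
  open ≡-Reasoning
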